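{- Let $k,\ell$ be integers with $k<\ell<\sqrt3k$ such that either (a) $k,\ell$ are odd and $\gcd(k,\ell)=1$, or (b) $k,\ell$ are even, $\gcd(k,\ell)=2$ and $8\mid k\ell$. Then there exist positive integers $d_1,d_2$ such that $d=d_1d_2$ is squarefree, $d\equiv1\pmod 4$, $d_1<d_2<3d_1$ and $k^2d_2-\ell^2d_1=\pm4$. Moreover, if $(d_1',d_2',k,\ell)$ is any tuple of integers with $d_1',d_2'>0$, $d_1'd_2'$ squarefree, $d_1'd_2'\equiv1\pmod 4$, $d_1'<d_2'<3d_1'$ and $k^2d_2'-\ell^2d_1'=\pm4$, then for infinitely many integers $n$ the tuple $(d_1'',d_2'',k,\ell)$ satisfies the same conditions, where $d_1''=d_1'+2k^2n$, $d_2''=d_2'+2\ell^2n$ if $k,\ell$ are odd, and $d_1''=d_1'+k^2n$, $d_2''=d_2'+\ell^2n$ if $k,\ell$ are even. -}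

module Defs where

open import Data.Nat as ℕ using (ℕ)
open import Data.Integer using (ℤ; +_; -_; _+_; _-_; _*_; _<_; ∣_∣)
open import Data.Integer.Divisibility using (_∣_)
open import Data.Integer.GCD using (gcd)
open import Data.Product using (_×_)
open import Data.Sum using (_⊎_)
open import Relation.Nullary using (¬_)
open import Relation.Binary.PropositionalEquality using (_≡_)

-- An integer d is squarefree if the only natural number m with m² ∣ d is m = 1.
-- (Integer divisibility; 0 is not squarefree.)
SquareFree : ℤ → Set
SquareFree d = ∀ (m : ℕ) → (+ m * + m) ∣ d → m ≡ 1

CaseA : ℤ → ℤ → Set
CaseA k l = ¬ (+ 2 ∣ k) × ¬ (+ 2 ∣ l) × gcd k l ≡ + 1

CaseB : ℤ → ℤ → Set
CaseB k l = (+ 2 ∣ k) × (+ 2 ∣ l) × gcd k l ≡ + 2 × (+ 8 ∣ (k * l))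

Good : ℤ → ℤ → ℤ → ℤ → Set
Good d₁ d₂ k l =
  (+ 0 < d₁) × (+ 0 < d₂) × SquareFree (d₁ * d₂) × (+ 4 ∣ (d₁ * d₂ - + 1))
  × (d₁ < d₂) × (d₂ < + 3 * d₁)
  × ((k * k * d₂ - l * l * d₁ ≡ + 4) ⊎ (k * k * d₂ - l * l * d₁ ≡ - (+ 4)))

-- "For infinitely many integers n, P n": P holds for integers n of
-- arbitrarily large absolute value.
InfinitelyMany : (ℤ → Set) → Set
InfinitelyMany P = ∀ (N : ℕ) → Data.Product.∃ λ n → (N ℕ.< ∣ n ∣) × P n

-- Write K = k² and L = ℓ², and shift (d₁, d₂) to (d₁ + cKn, d₂ + cLn), with c = 2 in case (a)
-- and c = 1 in case (b). The shift keeps K d₂ − L d₁ fixed, K < L < 3K keeps d₁ < d₂ < 3d₁, and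
-- parity keeps d₁d₂ ≡ 1 (mod 4). A first pair is (y + Kt, x + Lt), where Kx − Ly = ±4 comes from
-- a Bézout relation between the coprime K and L (in case (b), between (k/2)² and (ℓ/2)², with
-- ±1 in place of ±4), and t is large and fixed modulo 4.
-- Squarefreeness along the shifts comes from a sieve. Both linear forms take odd values that
-- are coprime to each other and to the slopes, so the n at which p² divides one of them lie at
-- least p² apart. Among M = 1 + 4r consecutive n, at most Σ_{1 ≤ i ≤ r} 2(M/(2i+1)² + 1) < M
-- have a value divisible by the square of a prime p ≤ 2r + 1, and for r large every value is
-- below (2r + 1)².

module Submission where

open import Defs

module Arithmetic where

  open import Data.Empty using (⊥-elim)
  open import Data.List.Base using ([]; _∷_)
  open import Data.List.Relation.Unary.All using (_∷_)
  open import Data.Nat.Base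
  open import Data.Nat.Properties
  open import Data.Nat.Divisibility
  open import Data.Nat.Coprimality using (Coprime; coprime-divisor)
  import Data.Nat.Coprimality as Coprimality
  open import Data.Nat.ListAction using (product)
  open import Data.Nat.Primality
    using (Prime; prime[2]; ¬prime[1]; euclidsLemma; prime⇒nonZero; prime⇒irreducible)
  open import Data.Nat.Primality.Factorisation using (factorise)
  open import Data.Nat.Tactic.RingSolver using (solve-∀)
  open import Data.Product using (∃; _×_; _,_)
  open import Data.Sum using (inj₁; inj₂; reduce)
  open import Relation.Binary.PropositionalEquality
  open import Relation.Nullary using (¬_; contradiction)

  ¬2∣⇒odd : ∀ {n} → ¬ 2 ∣ n → ∃ λ h → n ≡ 1 + 2 * h
  ¬2∣⇒odd {zero}        ¬2∣n = ⊥-elim (¬2∣n (2 ∣0))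
  ¬2∣⇒odd {suc zero}    _    = 0 , refl
  ¬2∣⇒odd {suc (suc n)} ¬2∣n with ¬2∣⇒odd {n} (λ 2∣n → ¬2∣n (∣m∣n⇒∣m+n ∣-refl 2∣n))
  ... | h , refl = suc h , cong (2 +_) (sym (+-suc h (h + 0)))

  ¬2∣1+2* : ∀ h → ¬ 2 ∣ 1 + 2 * h
  ¬2∣1+2* h 2∣ = contradiction (∣1⇒≡1 (∣m+n∣m⇒∣n (subst (2 ∣_) (+-comm 1 (2 * h)) 2∣) (m∣m*n h))) λ ()

  odd*odd : ∀ {m n} → ¬ 2 ∣ m → ¬ 2 ∣ n → ¬ 2 ∣ m * n
  odd*odd {m} {n} ¬2∣m ¬2∣n 2∣mn with euclidsLemma m n prime[2] 2∣mn
  ... | inj₁ 2∣m = ¬2∣m 2∣m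
  ... | inj₂ 2∣n = ¬2∣n 2∣n

  odd+odd : ∀ {m n} → ¬ 2 ∣ m → ¬ 2 ∣ n → 2 ∣ m + n
  odd+odd ¬2∣m ¬2∣n with ¬2∣⇒odd ¬2∣m | ¬2∣⇒odd ¬2∣n
  ... | g , refl | h , refl = divides (1 + g + h) (solve g h)
    where
    solve : ∀ g h → 1 + 2 * g + (1 + 2 * h) ≡ (1 + g + h) * 2
    solve = solve-∀

  odd-square : ∀ {n} → ¬ 2 ∣ n → ∃ λ w → n * n ≡ 1 + 4 * w
  odd-square ¬2∣n with ¬2∣⇒odd ¬2∣n
  ... | h , refl = h + h * h , solve h
    where
    solve : ∀ h → (1 + 2 * h) * (1 + 2 * h) ≡ 1 + 4 * (h + h * h)
    solve = solve-∀

  odd-mod4-product : ∀ {t} → ¬ 2 ∣ t → ∀ P Q → 4 ∣ (t + 4 * P) * (t + 4 * Q) ∸ 1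
  odd-mod4-product ¬2∣t P Q with ¬2∣⇒odd ¬2∣t
  ... | h , refl = subst (λ n → 4 ∣ n ∸ 1) (sym (solve h P Q)) (m∣m*n W)
    where
    W = h + h * h + (1 + 2 * h) * (P + Q) + 4 * P * Q
    solve : ∀ h P Q → (1 + 2 * h + 4 * P) * (1 + 2 * h + 4 * Q)
                      ≡ 1 + 4 * (h + h * h + (1 + 2 * h) * (P + Q) + 4 * P * Q)
    solve = solve-∀

  ≡1-mod-4⇒odd : ∀ {n} → 1 ≤ n → 4 ∣ n ∸ 1 → ¬ 2 ∣ n
  ≡1-mod-4⇒odd {n} 1≤n 4∣n-1 2∣n = contradiction (∣1⇒≡1 2∣1) λ ()
    where
    2∣1 : 2 ∣ 1
    2∣1 = ∣m+n∣m⇒∣n (subst (2 ∣_) (sym (m∸n+n≡m 1≤n)) 2∣n) (∣-trans (divides 2 refl) 4∣n-1)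

  prime∣2⇒≡2 : ∀ {p} → Prime p → p ∣ 2 → p ≡ 2
  prime∣2⇒≡2 prime[p] p∣2 with prime⇒irreducible prime[2] p∣2
  ... | inj₁ refl = contradiction prime[p] ¬prime[1]
  ... | inj₂ p≡2  = p≡2

  prime∣4⇒≡2 : ∀ {p} → Prime p → p ∣ 4 → p ≡ 2
  prime∣4⇒≡2 prime[p] p∣4 = prime∣2⇒≡2 prime[p] (reduce (euclidsLemma 2 2 prime[p] p∣4))

  ∃-prime-divisor : ∀ {m} → 2 ≤ m → ∃ λ p → Prime p × p ∣ m
  ∃-prime-divisor {m@(suc _)} 2≤m with factorise m
  ... | record { factors = [] ; isFactorisation = m≡1 } = ⊥-elim (<-irrefl (sym m≡1) 2≤m)
  ... | record { factors = p ∷ ps ; isFactorisation = m≡p*ps ; factorsPrime = prime[p] ∷ _ } =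
    p , prime[p] , divides (product ps) (trans m≡p*ps (*-comm p (product ps)))

  p*p∣m*n⇒p∤n⇒p*p∣m : ∀ {p m n} → Prime p → p * p ∣ m * n → ¬ p ∣ n → p * p ∣ m
  p*p∣m*n⇒p∤n⇒p*p∣m {p} {m} {n} prime[p] p²∣mn p∤n
    with euclidsLemma m n prime[p] (∣-trans (m∣m*n p) p²∣mn)
  ... | inj₂ p∣n = ⊥-elim (p∤n p∣n)
  ... | inj₁ (divides u refl)
    with euclidsLemma u n prime[p] (*-cancelʳ-∣ p {{prime⇒nonZero prime[p]}} p²∣unp)
    where
    p²∣unp : p * p ∣ u * n * p
    p²∣unp = subst (p * p ∣_) (solve u p n) p²∣mn
      where
      solve : ∀ u p n → u * p * n ≡ u * n * p
      solve = solve-∀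
  ...   | inj₁ p∣u = *-monoˡ-∣ p p∣u
  ...   | inj₂ p∣n = ⊥-elim (p∤n p∣n)

  coprime-*ʳ : ∀ {m n o} → Coprime m n → Coprime m o → Coprime m (n * o)
  coprime-*ʳ c₁ c₂ (d∣m , d∣no) =
    c₂ (d∣m , coprime-divisor (λ (e∣d , e∣n) → c₁ (∣-trans e∣d d∣m , e∣n)) d∣no)

  coprime-square : ∀ {m n} → Coprime m n → Coprime (m * m) (n * n)
  coprime-square c = Coprimality.sym (coprime-*ʳ c′ c′)
    where
    c′ = Coprimality.sym (coprime-*ʳ c c)

  SquareFreeℕ : ℕ → Set
  SquareFreeℕ n = ∀ m → m * m ∣ n → m ≡ 1

  NoPrimeSquare : ℕ → Set
  NoPrimeSquare n = ∀ {p} → Prime p → ¬ p * p ∣ n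

  noPrimeSquare⇒squareFree : ∀ {n} → NoPrimeSquare n → SquareFreeℕ n
  noPrimeSquare⇒squareFree noSq zero 0∣n =
    ⊥-elim (noSq prime[2] (subst (4 ∣_) (sym (0∣⇒≡0 0∣n)) (4 ∣0)))
  noPrimeSquare⇒squareFree noSq 1 _ = refl
  noPrimeSquare⇒squareFree noSq m@(suc (suc _)) m²∣n with ∃-prime-divisor {m} (s≤s (s≤s z≤n))
  ... | p , prime[p] , p∣m = ⊥-elim (noSq prime[p] (∣-trans (*-pres-∣ p∣m p∣m) m²∣n))

  noPrimeSquare-* : ∀ {m n} → (∀ {p} → Prime p → p ∣ m → ¬ p ∣ n) →
                    NoPrimeSquare m → NoPrimeSquare n → NoPrimeSquare (m * n)
  noPrimeSquare-* {m} {n} coprime noSq-m noSq-n {p} prime[p] p²∣mn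
    with euclidsLemma m n prime[p] (∣-trans (m∣m*n p) p²∣mn)
  ... | inj₁ p∣m = noSq-m prime[p] (p*p∣m*n⇒p∤n⇒p*p∣m prime[p] p²∣mn (coprime prime[p] p∣m))
  ... | inj₂ p∣n = noSq-n prime[p] (p*p∣m*n⇒p∤n⇒p*p∣m prime[p] (subst (p * p ∣_) (*-comm m n) p²∣mn)
                                       λ p∣m → coprime prime[p] p∣m p∣n)

  noPrimeSquare-odd : ∀ {n} r → ¬ 2 ∣ n → n ≤ (1 + 2 * r) * (1 + 2 * r) →
    (∀ {i} → 1 ≤ i → i ≤ r → Prime (1 + 2 * i) → ¬ (1 + 2 * i) * (1 + 2 * i) ∣ n) → NoPrimeSquare n
  noPrimeSquare-odd {n} r ¬2∣n n≤ odd-hyp {p} prime[p] p²∣n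
    with ¬2∣⇒odd {p} (λ 2∣p → ¬2∣n (∣-trans 2∣p (∣-trans (m∣m*n p) p²∣n)))
  ... | zero  , refl = ¬prime[1] prime[p]
  ... | suc i , refl = odd-hyp (s≤s z≤n) (*-cancelˡ-≤ 2 (s≤s⁻¹ p≤)) prime[p] p²∣n
    where
    n≢0 : NonZero n
    n≢0 = ≢-nonZero λ n≡0 → ¬2∣n (subst (2 ∣_) (sym n≡0) (2 ∣0))
    p≤ : p ≤ 1 + 2 * r
    p≤ = ≮⇒≥ λ r<p → <-irrefl refl (<-≤-trans (*-mono-< r<p r<p) (≤-trans (∣⇒≤ {{n≢0}} p²∣n) n≤))

module Counting where

  open import Data.Bool.Base using (if_then_else_)
  open import Data.Empty using (⊥-elim)
  open import Data.Nat.Base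
  open import Data.Nat.Properties
  open import Data.Nat.DivMod using (_/_; m≡m%n+[m/n]*n; m%n<n)
  open import Data.Product using (∃; _×_; _,_)
  open import Level using (0ℓ)
  open import Relation.Binary.PropositionalEquality
  open import Relation.Nullary using (does; yes; no; ¬_)
  open import Relation.Unary using (Pred; Decidable)
  open import Relation.Unary.Properties using (_∪?_)

  count : {P : Pred ℕ 0ℓ} → Decidable P → ℕ → ℕ → ℕ
  count P? a zero    = 0
  count P? a (suc m) = (if does (P? a) then 1 else 0) + count P? (suc a) m

  Sparse : Pred ℕ 0ℓ → ℕ → Set
  Sparse P q = ∀ {m n} → P m → P n → m < n → m + q ≤ n

  count-∪ : ∀ {P Q} (P? : Decidable P) (Q? : Decidable Q) a m →
            count (P? ∪? Q?) a m ≤ count P? a m + count Q? a m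
  count-∪ P? Q? a zero    = z≤n
  count-∪ P? Q? a (suc m) with P? a | Q? a | count-∪ P? Q? (suc a) m
  ... | yes _ | yes _ | ih = s≤s (≤-trans ih (+-monoʳ-≤ _ (n≤1+n _)))
  ... | yes _ | no  _ | ih = s≤s ih
  ... | no  _ | yes _ | ih = ≤-trans (s≤s ih) (≤-reflexive (sym (+-suc _ _)))
  ... | no  _ | no  _ | ih = ih

  module _ {P : Pred ℕ 0ℓ} (P? : Decidable P) where

    count-++ : ∀ a m n → count P? a (m + n) ≡ count P? a m + count P? (a + m) n
    count-++ a zero    n = cong (λ b → count P? b n) (sym (+-identityʳ a))
    count-++ a (suc m) n = begin
      δ + count P? (suc a) (m + n)                       ≡⟨ cong (δ +_) (count-++ (suc a) m n) ⟩
      δ + (count P? (suc a) m + count P? (suc a + m) n)  ≡⟨ +-assoc δ _ _ ⟨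
      count P? a (suc m) + count P? (suc (a + m)) n      ≡⟨ cong (λ b → δ + c + count P? b n) (+-suc a m) ⟨
      count P? a (suc m) + count P? (a + suc m) n        ∎
      where
      open ≡-Reasoning
      δ = if does (P? a) then 1 else 0
      c = count P? (suc a) m

    count-none : ∀ a m → (∀ n → a ≤ n → n < a + m → ¬ P n) → count P? a m ≡ 0
    count-none a zero    _  = refl
    count-none a (suc m) ¬P with P? a
    ... | yes p = ⊥-elim (¬P a ≤-refl (m<m+n a z<s) p)
    ... | no  _ = count-none (suc a) m λ n a<n n< →
                    ¬P n (<⇒≤ a<n) (subst (n <_) (sym (+-suc a m)) n<)

    count<⇒∃¬ : ∀ a m → count P? a m < m → ∃ λ n → a ≤ n × n < a + m × ¬ P n
    count<⇒∃¬ a (suc m) c<m with P? a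
    ... | no ¬p = a , ≤-refl , m<m+n a z<s , ¬p
    ... | yes _ with count<⇒∃¬ (suc a) m (s≤s⁻¹ c<m)
    ...   | n , a<n , n< , ¬p = n , <⇒≤ a<n , subst (n <_) (sym (+-suc a m)) n< , ¬p

    module _ {q} (sparse : Sparse P q) where

      count-≤1 : ∀ a j → j ≤ q → count P? a j ≤ 1
      count-≤1 a zero    _   = z≤n
      count-≤1 a (suc j) j<q with P? a
      ... | no  _ = count-≤1 (suc a) j (<⇒≤ j<q)
      ... | yes p = s≤s (≤-reflexive (count-none (suc a) j λ n a<n n< pn →
                      <-irrefl refl (<-≤-trans (n<a+q n n<) (sparse p pn a<n))))
        where
        n<a+q : ∀ n → n < suc a + j → n < a + q
        n<a+q n n< = <-≤-trans (subst (n <_) (sym (+-suc a j)) n<) (+-monoʳ-≤ a j<q)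

      count-blocks : ∀ t a → count P? a (t * q) ≤ t
      count-blocks zero    a = z≤n
      count-blocks (suc t) a = begin
        count P? a (q + t * q)                   ≡⟨ count-++ a q (t * q) ⟩
        count P? a q + count P? (a + q) (t * q)  ≤⟨ +-mono-≤ (count-≤1 a q ≤-refl) (count-blocks t (a + q)) ⟩
        suc t                                    ∎
        where open ≤-Reasoning

      count-sparse : .{{_ : NonZero q}} → ∀ a m → count P? a m ≤ suc (m / q)
      count-sparse a m = begin
        count P? a m                             ≤⟨ m≤m+n _ _ ⟩
        count P? a m + count P? (a + m) (M ∸ m)  ≡⟨ count-++ a m (M ∸ m) ⟨
        count P? a (m + (M ∸ m))                 ≡⟨ cong (count P? a) (m+[n∸m]≡n m≤M) ⟩
        count P? a M                             ≤⟨ count-blocks (suc (m / q)) a ⟩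
        suc (m / q)                              ∎
        where
        open ≤-Reasoning
        M = suc (m / q) * q
        m≤M : m ≤ M
        m≤M = subst (_≤ M) (sym (m≡m%n+[m/n]*n m q)) (+-monoˡ-≤ (m / q * q) (<⇒≤ (m%n<n m q)))

module Sieve where

  open import Data.Empty using (⊥)
  open import Data.Nat.Base
  open import Data.Nat.Properties
  open import Data.Nat.Divisibility
  open import Data.Nat.DivMod using (_/_; m/n*n≤m)
  open import Data.Nat.Primality using (Prime; prime?)
  open import Data.Nat.Tactic.RingSolver using (solve-∀)
  open import Data.Product using (∃; _×_; _,_; map₂)
  open import Data.Sum using (_⊎_; inj₁; inj₂)
  open import Level using (0ℓ)
  open import Relation.Binary.PropositionalEquality
  open import Relation.Nullary using (¬_; no; _×-dec_; contradiction)
  open import Relation.Unary using (Pred; Decidable)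
  open import Relation.Unary.Properties using (_∪?_)
  open Arithmetic
  open Counting

  prime²∣-sparse : ∀ {p a b} → Prime p → (∀ {ν} → p ∣ a + b * ν → ¬ p ∣ b) →
                   Sparse (λ ν → p * p ∣ a + b * ν) (p * p)
  prime²∣-sparse {p} {a} {b} prime[p] p∤b {m} {n} p²∣am p²∣an m<n = begin
    m + p * p    ≤⟨ +-monoʳ-≤ m (∣⇒≤ {{>-nonZero (m<n⇒0<n∸m m<n)}} p²∣n-m) ⟩
    m + (n ∸ m)  ≡⟨ m+[n∸m]≡n (<⇒≤ m<n) ⟩
    n            ∎
    where
    open ≤-Reasoning
    an≡am+[n-m]b : a + b * n ≡ (a + b * m) + (n ∸ m) * b
    an≡am+[n-m]b = trans (cong (λ x → a + b * x) (sym (m+[n∸m]≡n (<⇒≤ m<n)))) (solve a b m (n ∸ m))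
      where
      solve : ∀ a b m d → a + b * (m + d) ≡ (a + b * m) + d * b
      solve = solve-∀
    p²∣n-m : p * p ∣ n ∸ m
    p²∣n-m = p*p∣m*n⇒p∤n⇒p*p∣m prime[p]
      (∣m+n∣m⇒∣n (subst (p * p ∣_) an≡am+[n-m]b p²∣an) p²∣am) (p∤b (∣-trans (m∣m*n p) p²∣am))

  Hit : ℕ → ℕ → ℕ → Pred ℕ 0ℓ
  Hit a b i ν = Prime (1 + 2 * i) × (1 + 2 * i) * (1 + 2 * i) ∣ a + b * ν

  hit? : ∀ a b i → Decidable (Hit a b i)
  hit? a b i ν = prime? (1 + 2 * i) ×-dec ((1 + 2 * i) * (1 + 2 * i) ∣? a + b * ν)

  count-hit : ∀ {a b} → (∀ {ν p} → Prime p → p ∣ a + b * ν → ¬ p ∣ b) →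
              ∀ i A M → count (hit? a b i) A M ≤ suc (M / ((1 + 2 * i) * (1 + 2 * i)))
  count-hit {a} {b} p∤b i = count-sparse (hit? a b i) sparse
    where
    sparse : Sparse (Hit a b i) ((1 + 2 * i) * (1 + 2 * i))
    sparse (prime[p] , p²∣am) (_ , p²∣an) = prime²∣-sparse {a = a} {b} prime[p] (p∤b prime[p]) p²∣am p²∣an

  quotientSum : ℕ → ℕ → ℕ
  quotientSum zero    M = 0
  quotientSum (suc r) M = M / ((1 + 2 * suc r) * (1 + 2 * suc r)) + quotientSum r M

  -- 1/(2i+1)² < 1/(4i(i+1)) = 1/(4i) − 1/(4(i+1)), so the sum telescopes.
  quotientSum-telescope : ∀ r M → 4 * suc r * quotientSum r M ≤ M * r
  quotientSum-telescope zero    M = z≤n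
  quotientSum-telescope (suc r) M = *-cancelˡ-≤ (suc r) (begin
    suc r * (4 * suc (suc r) * (x + S))                          ≡⟨ expand r x S ⟩
    4 * suc r * suc (suc r) * x + suc (suc r) * (4 * suc r * S)  ≤⟨ +-mono-≤ x-step S-step ⟩
    x * q + suc (suc r) * (M * r)                                ≤⟨ +-monoˡ-≤ _ (m/n*n≤m M q) ⟩
    M + suc (suc r) * (M * r)                                    ≡⟨ collect r M ⟩
    suc r * (M * suc r)                                          ∎)
    where
    open ≤-Reasoning
    q = (1 + 2 * suc r) * (1 + 2 * suc r)
    x = M / q
    S = quotientSum r M
    expand : ∀ r x S → suc r * (4 * suc (suc r) * (x + S))
                       ≡ 4 * suc r * suc (suc r) * x + suc (suc r) * (4 * suc r * S)
    expand = solve-∀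
    collect : ∀ r M → M + suc (suc r) * (M * r) ≡ suc r * (M * suc r)
    collect = solve-∀
    square : ∀ r → (1 + 2 * suc r) * (1 + 2 * suc r) ≡ 4 * suc r * suc (suc r) + 1
    square = solve-∀
    x-step : 4 * suc r * suc (suc r) * x ≤ x * q
    x-step = subst (_≤ x * q) (*-comm x _)
      (*-monoʳ-≤ x (≤-trans (m≤m+n _ 1) (≤-reflexive (sym (square r)))))
    S-step : suc (suc r) * (4 * suc r * S) ≤ suc (suc r) * (M * r)
    S-step = *-monoʳ-≤ (suc (suc r)) (quotientSum-telescope r M)

  quotientSum-bound : ∀ r M → 4 * quotientSum r M ≤ M
  quotientSum-bound r M = *-cancelˡ-≤ (suc r) (begin
    suc r * (4 * S)  ≡⟨ reassociate r S ⟩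
    4 * suc r * S    ≤⟨ quotientSum-telescope r M ⟩
    M * r            ≤⟨ *-monoʳ-≤ M (n≤1+n r) ⟩
    M * suc r        ≡⟨ *-comm M (suc r) ⟩
    suc r * M        ∎)
    where
    open ≤-Reasoning
    S = quotientSum r M
    reassociate : ∀ r S → suc r * (4 * S) ≡ 4 * suc r * S
    reassociate = solve-∀

  linear-value-bound : ∀ C N {a b ν} → a ≤ C → b ≤ C → ν < suc N + suc (4 * (C * (2 + N))) →
                       a + b * ν ≤ (1 + 2 * (C * (2 + N))) * (1 + 2 * (C * (2 + N)))
  linear-value-bound C N {a} {b} {ν} a≤C b≤C ν< = begin
    a + b * ν                      ≤⟨ +-mono-≤ a≤C (*-monoˡ-≤ ν b≤C) ⟩
    C + C * ν                      ≡⟨ *-suc C ν ⟨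
    C * suc ν                      ≤⟨ *-monoʳ-≤ C ν< ⟩
    C * (suc N + suc (4 * r))      ≡⟨ split C N r ⟩
    r + C * (4 * r)                ≤⟨ +-monoʳ-≤ r (*-monoˡ-≤ (4 * r) (m≤m*n C (2 + N))) ⟩
    r + r * (4 * r)                ≤⟨ m≤m+n _ (1 + 3 * r) ⟩
    r + r * (4 * r) + (1 + 3 * r)  ≡⟨ square r ⟩
    (1 + 2 * r) * (1 + 2 * r)      ∎
    where
    open ≤-Reasoning
    r = C * (2 + N)
    split : ∀ C N r → C * (suc N + suc (4 * r)) ≡ C * (2 + N) + C * (4 * r)
    split = solve-∀
    square : ∀ r → r + r * (4 * r) + (1 + 3 * r) ≡ (1 + 2 * r) * (1 + 2 * r)
    square = solve-∀

  module SquarefreeValues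
    (a₁ b₁ a₂ b₂ : ℕ)
    (odd₁ : ∀ ν → ¬ 2 ∣ a₁ + b₁ * ν)
    (odd₂ : ∀ ν → ¬ 2 ∣ a₂ + b₂ * ν)
    (p∤b₁ : ∀ {ν p} → Prime p → p ∣ a₁ + b₁ * ν → ¬ p ∣ b₁)
    (p∤b₂ : ∀ {ν p} → Prime p → p ∣ a₂ + b₂ * ν → ¬ p ∣ b₂)
    (coprime : ∀ {ν p} → Prime p → p ∣ a₁ + b₁ * ν → ¬ p ∣ a₂ + b₂ * ν)
    where

    Bad : ℕ → Pred ℕ 0ℓ
    Bad zero    ν = ⊥
    Bad (suc r) ν = (Hit a₁ b₁ (suc r) ν ⊎ Hit a₂ b₂ (suc r) ν) ⊎ Bad r ν

    bad? : ∀ r → Decidable (Bad r)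
    bad? zero    _ = no λ ()
    bad? (suc r)   = (hit? a₁ b₁ (suc r) ∪? hit? a₂ b₂ (suc r)) ∪? bad? r

    Bad-intro : ∀ {r i ν} → 1 ≤ i → i ≤ r → Hit a₁ b₁ i ν ⊎ Hit a₂ b₂ i ν → Bad r ν
    Bad-intro {zero}  1≤i i≤0 _ = contradiction (≤-trans 1≤i i≤0) λ ()
    Bad-intro {suc r} 1≤i i≤r hit with m≤n⇒m<n∨m≡n i≤r
    ... | inj₂ refl = inj₁ hit
    ... | inj₁ i<r  = inj₂ (Bad-intro 1≤i (s≤s⁻¹ i<r) hit)

    count-bad : ∀ r A M → count (bad? r) A M ≤ 2 * quotientSum r M + 2 * r
    count-bad zero    A M = ≤-reflexive (count-none (bad? zero) A M λ _ _ _ ())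
    count-bad (suc r) A M = begin
      count (bad? (suc r)) A M                       ≤⟨ count-∪ (hit₁ ∪? hit₂) (bad? r) A M ⟩
      count (hit₁ ∪? hit₂) A M + count (bad? r) A M  ≤⟨ +-mono-≤ count-hits (count-bad r A M) ⟩
      (suc x + suc x) + (2 * S + 2 * r)              ≡⟨ regroup x S r ⟩
      2 * (x + S) + 2 * suc r                        ∎
      where
      open ≤-Reasoning
      hit₁ = hit? a₁ b₁ (suc r)
      hit₂ = hit? a₂ b₂ (suc r)
      x = M / ((1 + 2 * suc r) * (1 + 2 * suc r))
      S = quotientSum r M
      count-hits : count (hit₁ ∪? hit₂) A M ≤ suc x + suc x
      count-hits = ≤-trans (count-∪ hit₁ hit₂ A M)
        (+-mono-≤ (count-hit p∤b₁ (suc r) A M) (count-hit p∤b₂ (suc r) A M))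
      regroup : ∀ x S r → (suc x + suc x) + (2 * S + 2 * r) ≡ 2 * (x + S) + 2 * suc r
      regroup = solve-∀

    count-bad<window : ∀ r A → count (bad? r) A (suc (4 * r)) < suc (4 * r)
    count-bad<window r A = *-cancelˡ-< 2 _ _ (begin-strict
      2 * count (bad? r) A M  ≤⟨ *-monoʳ-≤ 2 (count-bad r A M) ⟩
      2 * (2 * S + 2 * r)     ≡⟨ distribute S r ⟩
      4 * S + 4 * r           <⟨ +-mono-≤-< (quotientSum-bound r M) (n<1+n (4 * r)) ⟩
      M + M                   ≡⟨ cong (M +_) (+-identityʳ M) ⟨
      2 * M                   ∎)
      where
      open ≤-Reasoning
      M = suc (4 * r)
      S = quotientSum r M
      distribute : ∀ S r → 2 * (2 * S + 2 * r) ≡ 4 * S + 4 * r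
      distribute = solve-∀

    squarefree-at : ∀ r ν → ¬ Bad r ν →
                    a₁ + b₁ * ν ≤ (1 + 2 * r) * (1 + 2 * r) → a₂ + b₂ * ν ≤ (1 + 2 * r) * (1 + 2 * r) →
                    SquareFreeℕ ((a₁ + b₁ * ν) * (a₂ + b₂ * ν))
    squarefree-at r ν ¬bad bound₁ bound₂ = noPrimeSquare⇒squareFree (noPrimeSquare-* coprime
      (noPrimeSquare-odd r (odd₁ ν) bound₁ λ 1≤i i≤r prime[p] p²∣ →
        ¬bad (Bad-intro 1≤i i≤r (inj₁ (prime[p] , p²∣))))
      (noPrimeSquare-odd r (odd₂ ν) bound₂ λ 1≤i i≤r prime[p] p²∣ →
        ¬bad (Bad-intro 1≤i i≤r (inj₂ (prime[p] , p²∣)))))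

    -- With r = C(N + 2), all values on the window of length 1 + 4r starting at N + 1 are at most
    -- (1 + 2r)², and by count-bad<window some point of that window is not Bad r.
    squarefree-values : ∀ N → ∃ λ ν → N < ν × SquareFreeℕ ((a₁ + b₁ * ν) * (a₂ + b₂ * ν))
    squarefree-values N = map₂
      (λ (N<ν , ν< , ¬bad) → N<ν , squarefree-at r _ ¬bad
        (linear-value-bound C N a₁≤C b₁≤C ν<) (linear-value-bound C N a₂≤C b₂≤C ν<))
      (count<⇒∃¬ (bad? r) (suc N) (suc (4 * r)) (count-bad<window r (suc N)))
      where
      C = (a₁ + b₁) + (a₂ + b₂)
      r = C * (2 + N)
      a₁≤C = ≤-trans (m≤m+n a₁ b₁) (m≤m+n _ (a₂ + b₂))
      b₁≤C = ≤-trans (m≤n+m b₁ a₁) (m≤m+n _ (a₂ + b₂))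
      a₂≤C = ≤-trans (m≤m+n a₂ b₂) (m≤n+m _ (a₁ + b₁))
      b₂≤C = ≤-trans (m≤n+m b₂ a₂) (m≤n+m _ (a₁ + b₁))

module Admissibility where

  open import Data.Nat.Base
  open import Data.Nat.Properties
  open import Data.Nat.Divisibility
  open import Data.Nat.Coprimality using (Coprime; coprime-Bézout; gcd≡1⇒coprime)
  open import Data.Nat.GCD using (gcd; module Bézout; c*gcd[m,n]≡gcd[cm,cn])
  open import Data.Nat.Primality using (Prime; prime[2]; euclidsLemma)
  open import Data.Nat.Tactic.RingSolver using (solve-∀)
  open import Data.Product using (∃; ∃₂; _×_; _,_; map₂)
  open import Data.Sum using (_⊎_; inj₁; inj₂; swap)
  open import Relation.Binary.PropositionalEquality
  open import Relation.Nullary using (¬_; contradiction)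
  import Algebra.Properties.CommutativeSemigroup as CommutativeSemigroupProperties
  open CommutativeSemigroupProperties +-commutativeSemigroup using (xy∙z≈xz∙y)
  open CommutativeSemigroupProperties *-commutativeSemigroup using (x∙yz≈y∙xz)
  open Arithmetic
  open Sieve

  Differ : ℕ → ℕ → ℕ → Set
  Differ e x y = x ≡ y + e ⊎ y ≡ x + e

  differ-*ˡ : ∀ {e x y} c → Differ e x y → Differ (c * e) (c * x) (c * y)
  differ-*ˡ {e} {x} {y} c (inj₁ x≡y+e) = inj₁ (trans (cong (c *_) x≡y+e) (*-distribˡ-+ c y e))
  differ-*ˡ {e} {x} {y} c (inj₂ y≡x+e) = inj₂ (trans (cong (c *_) y≡x+e) (*-distribˡ-+ c x e))

  differ-+ : ∀ {e x y} z → Differ e x y → Differ e (x + z) (y + z)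
  differ-+ {e} {x} {y} z (inj₁ x≡y+e) = inj₁ (trans (cong (_+ z) x≡y+e) (xy∙z≈xz∙y y e z))
  differ-+ {e} {x} {y} z (inj₂ y≡x+e) = inj₂ (trans (cong (_+ z) y≡x+e) (xy∙z≈xz∙y x e z))

  differ-shift : ∀ {e K L x y} u v → K * v ≡ L * u →
                 Differ e (K * x) (L * y) → Differ e (K * (x + v)) (L * (y + u))
  differ-shift {e} {K} {L} {x} {y} u v Kv≡Lu ±e =
    subst₂ (Differ e) (sym (*-distribˡ-+ K x v)) (trans (cong (L * y +_) Kv≡Lu) (sym (*-distribˡ-+ L y u)))
      (differ-+ (K * v) ±e)

  differ-∣ : ∀ {e x y d} → Differ e x y → d ∣ x → d ∣ y → d ∣ e
  differ-∣ {d = d} (inj₁ x≡y+e) d∣x d∣y = ∣m+n∣m⇒∣n (subst (d ∣_) x≡y+e d∣x) d∣y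
  differ-∣ {d = d} (inj₂ y≡x+e) d∣x d∣y = ∣m+n∣m⇒∣n (subst (d ∣_) y≡x+e d∣y) d∣x

  differ-1-parity : ∀ {x y} → Differ 1 x y → 2 ∣ x → ¬ 2 ∣ y
  differ-1-parity ±1 2∣x 2∣y = contradiction (∣1⇒≡1 (differ-∣ ±1 2∣x 2∣y)) λ ()

  1+ab≡cd⇒dc≡ba+1 : ∀ {a b c d} → 1 + a * b ≡ c * d → d * c ≡ b * a + 1
  1+ab≡cd⇒dc≡ba+1 {a} {b} {c} {d} eq = begin
    d * c      ≡⟨ *-comm d c ⟩
    c * d      ≡⟨ eq ⟨
    1 + a * b  ≡⟨ +-comm 1 (a * b) ⟩
    a * b + 1  ≡⟨ cong (_+ 1) (*-comm a b) ⟩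
    b * a + 1  ∎
    where open ≡-Reasoning

  coprime⇒differ-1 : ∀ {K L} → Coprime K L → ∃₂ λ x y → Differ 1 (K * x) (L * y)
  coprime⇒differ-1 {K} {L} c with coprime-Bézout c
  ... | Bézout.+- x y 1+yL≡xK = x , y , inj₁ (1+ab≡cd⇒dc≡ba+1 {y} {L} {x} {K} 1+yL≡xK)
  ... | Bézout.-+ x y 1+xK≡yL = x , y , inj₂ (1+ab≡cd⇒dc≡ba+1 {x} {K} {y} {L} 1+xK≡yL)

  -- Good (+ d₁) (+ d₂) k ℓ without the squarefreeness of d₁d₂, where K = k² and L = ℓ².
  record Admissible (K L d₁ d₂ : ℕ) : Set where
    constructor admissible
    field
      d₁<d₂      : d₁ < d₂
      d₂<3d₁     : d₂ < 3 * d₁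
      d₁d₂≡1[4]  : 4 ∣ d₁ * d₂ ∸ 1
      Kd₂-Ld₁≡±4 : Differ 4 (K * d₂) (L * d₁)

    0<d₁ : 0 < d₁
    0<d₁ = *-cancelˡ-< 3 0 d₁ (≤-<-trans z≤n d₂<3d₁)

    1≤d₁d₂ : 1 ≤ d₁ * d₂
    1≤d₁d₂ = *-mono-≤ 0<d₁ (<-trans 0<d₁ d₁<d₂)

    d₁-odd : ¬ 2 ∣ d₁
    d₁-odd 2∣d₁ = ≡1-mod-4⇒odd 1≤d₁d₂ d₁d₂≡1[4] (∣m⇒∣m*n d₂ 2∣d₁)

    d₂-odd : ¬ 2 ∣ d₂
    d₂-odd 2∣d₂ = ≡1-mod-4⇒odd 1≤d₁d₂ d₁d₂≡1[4] (∣n⇒∣m*n d₁ 2∣d₂)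

    common-prime≡2 : ∀ {p} → Prime p → p ∣ K * d₂ → p ∣ L * d₁ → p ≡ 2
    common-prime≡2 prime[p] p∣Kd₂ p∣Ld₁ = prime∣4⇒≡2 prime[p] (differ-∣ Kd₂-Ld₁≡±4 p∣Kd₂ p∣Ld₁)

    p∣d₁⇒p∤d₂ : ∀ {p} → Prime p → p ∣ d₁ → ¬ p ∣ d₂
    p∣d₁⇒p∤d₂ prime[p] p∣d₁ p∣d₂ =
      d₁-odd (subst (_∣ d₁) (common-prime≡2 prime[p] (∣n⇒∣m*n K p∣d₂) (∣n⇒∣m*n L p∣d₁)) p∣d₁)

    p∣d₁⇒p∤K : ∀ {p} → Prime p → p ∣ d₁ → ¬ p ∣ K
    p∣d₁⇒p∤K prime[p] p∣d₁ p∣K =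
      d₁-odd (subst (_∣ d₁) (common-prime≡2 prime[p] (∣m⇒∣m*n d₂ p∣K) (∣n⇒∣m*n L p∣d₁)) p∣d₁)

    p∣d₂⇒p∤L : ∀ {p} → Prime p → p ∣ d₂ → ¬ p ∣ L
    p∣d₂⇒p∤L prime[p] p∣d₂ p∣L =
      d₂-odd (subst (_∣ d₂) (common-prime≡2 prime[p] (∣n⇒∣m*n K p∣d₂) (∣m⇒∣m*n d₁ p∣L)) p∣d₂)

  record SquarefreeShifts (K L b₁ b₂ : ℕ) : Set where
    field
      shift : ∀ {d₁ d₂} → Admissible K L d₁ d₂ → ∀ N → ∃ λ ν → N < ν ×
              Admissible K L (d₁ + b₁ * ν) (d₂ + b₂ * ν) × SquareFreeℕ ((d₁ + b₁ * ν) * (d₂ + b₂ * ν))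

  open SquarefreeShifts public

  module _ {K L c : ℕ} (K≤L : K ≤ L) (L≤3K : L ≤ 3 * K) where

    admissible-shift : ∀ {d₁ d₂} → 4 ∣ c * (d₁ * L + d₂ * K) → 4 ∣ c * K * (c * L) →
                       Admissible K L d₁ d₂ → ∀ ν → Admissible K L (d₁ + c * K * ν) (d₂ + c * L * ν)
    admissible-shift {d₁} {d₂} 4∣cross 4∣square adm ν = admissible
      (+-mono-<-≤ d₁<d₂ (*-monoˡ-≤ ν (*-monoʳ-≤ c K≤L)))
      (subst (d₂ + c * L * ν <_) (sym (*-distribˡ-+ 3 d₁ (c * K * ν))) (+-mono-<-≤ d₂<3d₁ cLν≤3cKν))
      (subst (4 ∣_) (sym product∸1)
        (∣m∣n⇒∣m+n d₁d₂≡1[4] (∣m∣n⇒∣m+n (∣n⇒∣m*n ν 4∣cross) (∣n⇒∣m*n (ν * ν) 4∣square))))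
      (differ-shift {K = K} {L} (c * K * ν) (c * L * ν) (reorder K L c ν) Kd₂-Ld₁≡±4)
      where
      open Admissible adm
      cLν≤3cKν : c * L * ν ≤ 3 * (c * K * ν)
      cLν≤3cKν = ≤-trans (*-monoˡ-≤ ν (*-monoʳ-≤ c L≤3K)) (≤-reflexive (solve c K ν))
        where
        solve : ∀ c K ν → c * (3 * K) * ν ≡ 3 * (c * K * ν)
        solve = solve-∀
      expand : ∀ d₁ d₂ c K L ν → (d₁ + c * K * ν) * (d₂ + c * L * ν)
               ≡ d₁ * d₂ + (ν * (c * (d₁ * L + d₂ * K)) + ν * ν * (c * K * (c * L)))
      expand = solve-∀
      product∸1 : (d₁ + c * K * ν) * (d₂ + c * L * ν) ∸ 1
                  ≡ d₁ * d₂ ∸ 1 + (ν * (c * (d₁ * L + d₂ * K)) + ν * ν * (c * K * (c * L)))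
      product∸1 = trans (cong (_∸ 1) (expand d₁ d₂ c K L ν)) (+-∸-comm _ 1≤d₁d₂)
      reorder : ∀ K L c ν → K * (c * L * ν) ≡ L * (c * K * ν)
      reorder = solve-∀

    squarefree-shifts : c ∣ 2 → (∀ {d₁ d₂} → Admissible K L d₁ d₂ → 4 ∣ c * (d₁ * L + d₂ * K)) →
                        4 ∣ c * K * (c * L) → SquarefreeShifts K L (c * K) (c * L)
    squarefree-shifts c∣2 4∣cross 4∣square .shift {d₁} {d₂} adm N =
      map₂ (λ {ν} (N<ν , squarefree) → N<ν , shifted ν , squarefree)
        (SquarefreeValues.squarefree-values d₁ (c * K) d₂ (c * L)
          (λ ν → Admissible.d₁-odd (shifted ν))
          (λ ν → Admissible.d₂-odd (shifted ν))
          (λ {ν} → p∤c* (Admissible.d₁-odd (shifted ν)) (Admissible.p∣d₁⇒p∤K (shifted ν)))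
          (λ {ν} → p∤c* (Admissible.d₂-odd (shifted ν)) (Admissible.p∣d₂⇒p∤L (shifted ν)))
          (λ {ν} → Admissible.p∣d₁⇒p∤d₂ (shifted ν))
          N)
      where
      shifted = admissible-shift (4∣cross adm) 4∣square adm
      p∤c* : ∀ {n m p} → ¬ 2 ∣ n → (Prime p → p ∣ n → ¬ p ∣ m) → Prime p → p ∣ n → ¬ p ∣ c * m
      p∤c* {n} {m} n-odd p∤m prime[p] p∣n p∣cm with euclidsLemma c m prime[p] p∣cm
      ... | inj₁ p∣c = n-odd (subst (_∣ n) (prime∣2⇒≡2 prime[p] (∣-trans p∣c c∣2)) p∣n)
      ... | inj₂ p∣m = p∤m prime[p] p∣n p∣m

  odd-squarefree-shifts : ∀ {K L} → ¬ 2 ∣ K → ¬ 2 ∣ L → K ≤ L → L ≤ 3 * K →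
                          SquarefreeShifts K L (2 * K) (2 * L)
  odd-squarefree-shifts {K} {L} K-odd L-odd K≤L L≤3K =
    squarefree-shifts K≤L L≤3K ∣-refl 4∣cross (*-pres-∣ (m∣m*n {2} K) (m∣m*n {2} L))
    where
    4∣cross : ∀ {d₁ d₂} → Admissible K L d₁ d₂ → 4 ∣ 2 * (d₁ * L + d₂ * K)
    4∣cross adm = *-monoʳ-∣ 2 (odd+odd (odd*odd d₁-odd L-odd) (odd*odd d₂-odd K-odd))
      where open Admissible adm

  even-squarefree-shifts : ∀ {K L} → 4 ∣ K → 4 ∣ L → K ≤ L → L ≤ 3 * K → SquarefreeShifts K L K L
  even-squarefree-shifts {K} {L} 4∣K 4∣L K≤L L≤3K =
    subst₂ (SquarefreeShifts K L) (*-identityˡ K) (*-identityˡ L)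
      (squarefree-shifts K≤L L≤3K (1∣ 2) 4∣cross (∣m⇒∣m*n (1 * L) (∣n⇒∣m*n 1 4∣K)))
    where
    4∣cross : ∀ {d₁ d₂} → Admissible K L d₁ d₂ → 4 ∣ 1 * (d₁ * L + d₂ * K)
    4∣cross {d₁} {d₂} _ = ∣n⇒∣m*n 1 (∣m∣n⇒∣m+n (∣n⇒∣m*n d₁ 4∣L) (∣n⇒∣m*n d₂ 4∣K))

  seed-ordered : ∀ {K L x y t} → K < L → y < t → y + K * t < x + L * t
  seed-ordered {K} {L} {x} {y} {t} K<L y<t =
    ≤-trans (+-monoˡ-< (K * t) y<t) (≤-trans (*-monoˡ-≤ t K<L) (m≤n+m (L * t) x))

  seed-bounded : ∀ {K L x y t} → L < 3 * K → x < t → x + L * t < 3 * (y + K * t)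
  seed-bounded {K} {L} {x} {y} {t} L<3K x<t =
    ≤-trans (+-monoˡ-< (L * t) x<t)
      (≤-trans (*-monoˡ-≤ t L<3K) (≤-trans (≤-reflexive (*-assoc 3 K t)) (*-monoʳ-≤ 3 (m≤n+m (K * t) y))))

  seed-differ : ∀ {e K L x y} t → Differ e (K * x) (L * y) → Differ e (K * (x + L * t)) (L * (y + K * t))
  seed-differ {K = K} {L} t = differ-shift {K = K} {L} (K * t) (L * t) (x∙yz≈y∙xz K L t)

  -- K ≡ L ≡ 1 (mod 4), so both entries are ≡ t (mod 4), and t is odd.
  odd-seed : ∀ {κ ℓ} → ¬ 2 ∣ κ → ¬ 2 ∣ ℓ → Coprime κ ℓ → κ < ℓ → ℓ * ℓ < 3 * (κ * κ) →
             ∃₂ (Admissible (κ * κ) (ℓ * ℓ))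
  odd-seed {κ} {ℓ} κ-odd ℓ-odd coprime κ<ℓ ℓ²<3κ² with coprime⇒differ-1 (coprime-square coprime)
  ... | x , y , ±1 = 4 * y + K * t , 4 * x + L * t ,
    admissible (seed-ordered {K} {L} {4 * x} (*-mono-< κ<ℓ κ<ℓ) 4y<t)
               (seed-bounded {K} {L} {4 * x} {4 * y} ℓ²<3κ² 4x<t)
               ≡1-mod-4
               (seed-differ {K = K} {L} t ±4)
    where
    K = κ * κ
    L = ℓ * ℓ
    t = 1 + 2 * (2 * (x + y))
    4x+4y<t : 4 * x + 4 * y < t
    4x+4y<t = s≤s (≤-reflexive (solve x y))
      where
      solve : ∀ x y → 4 * x + 4 * y ≡ 2 * (2 * (x + y))
      solve = solve-∀
    4x<t : 4 * x < t
    4x<t = ≤-<-trans (m≤m+n (4 * x) (4 * y)) 4x+4y<t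
    4y<t : 4 * y < t
    4y<t = ≤-<-trans (m≤n+m (4 * y) (4 * x)) 4x+4y<t
    ±4 : Differ 4 (K * (4 * x)) (L * (4 * y))
    ±4 = subst₂ (Differ 4) (x∙yz≈y∙xz 4 K x) (x∙yz≈y∙xz 4 L y) (differ-*ˡ 4 ±1)
    t+4* : ∀ {M w} z → M ≡ 1 + 4 * w → 4 * z + M * t ≡ t + 4 * (z + w * t)
    t+4* {M} {w} z M≡1+4w = trans (cong (λ M → 4 * z + M * t) M≡1+4w) (solve z w t)
      where
      solve : ∀ z w t → 4 * z + (1 + 4 * w) * t ≡ t + 4 * (z + w * t)
      solve = solve-∀
    ≡1-mod-4 : 4 ∣ (4 * y + K * t) * (4 * x + L * t) ∸ 1
    ≡1-mod-4 with odd-square κ-odd | odd-square ℓ-odd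
    ... | w₁ , K≡1+4w₁ | w₂ , L≡1+4w₂ =
      subst₂ (λ a b → 4 ∣ a * b ∸ 1) (sym (t+4* {w = w₁} y K≡1+4w₁)) (sym (t+4* {w = w₂} x L≡1+4w₂))
        (odd-mod4-product (¬2∣1+2* (2 * (x + y))) (y + w₁ * t) (x + w₂ * t))

  m<m+3n+4 : ∀ m n → m < m + 3 * n + 4
  m<m+3n+4 m n = ≤-<-trans (m≤m+n m (3 * n)) (m<m+n (m + 3 * n) z<s)

  n<m+3n+4 : ∀ m n → n < m + 3 * n + 4
  n<m+3n+4 m n = ≤-<-trans (≤-trans (m≤n*m n 3) (m≤n+m (3 * n) m)) (m<m+n (m + 3 * n) z<s)

  -- t = y + 3x + 4 ≡ y − x (mod 4) makes both entries ≡ y (mod 4).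
  seed-≡1-mod-4 : ∀ {K L E w x y} → K ≡ 4 * E → L ≡ 1 + 4 * w → ¬ 2 ∣ y →
                  4 ∣ (y + K * (y + 3 * x + 4)) * (x + L * (y + 3 * x + 4)) ∸ 1
  seed-≡1-mod-4 {E = E} {w} {x} {y} refl refl y-odd =
    subst (λ n → 4 ∣ n ∸ 1) (sym (cong₂ _*_ (solve₁ y E t) (solve₂ x y w)))
      (odd-mod4-product y-odd (E * t) (x + 1 + w * t))
    where
    t = y + 3 * x + 4
    solve₁ : ∀ y E t → y + 4 * E * t ≡ y + 4 * (E * t)
    solve₁ = solve-∀
    solve₂ : ∀ x y w → x + (1 + 4 * w) * (y + 3 * x + 4) ≡ y + 4 * (x + 1 + w * (y + 3 * x + 4))
    solve₂ = solve-∀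

  even-seed : ∀ {κ ℓ} → Coprime κ ℓ → 2 ∣ κ ⊎ 2 ∣ ℓ → κ < ℓ → ℓ * ℓ < 3 * (κ * κ) →
              ∃₂ (Admissible (κ * 2 * (κ * 2)) (ℓ * 2 * (ℓ * 2)))
  even-seed {κ} {ℓ} coprime 2∣κ⊎2∣ℓ κ<ℓ ℓ²<3κ² = seeded (coprime⇒differ-1 (coprime-square coprime)) 2∣κ⊎2∣ℓ
    where
    K = κ * κ
    L = ℓ * ℓ
    quadruple : ∀ k a → 4 * (k * k * a) ≡ k * 2 * (k * 2) * a
    quadruple = solve-∀
    square≡4* : ∀ {k} e → k ≡ e * 2 → k * k ≡ 4 * (e * e)
    square≡4* e refl = solve e
      where
      solve : ∀ e → e * 2 * (e * 2) ≡ 4 * (e * e)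
      solve = solve-∀
    seed-at : ∀ {x y} t → Differ 1 (K * x) (L * y) → y < t → x < t → 4 ∣ (y + K * t) * (x + L * t) ∸ 1 →
              ∃₂ (Admissible (κ * 2 * (κ * 2)) (ℓ * 2 * (ℓ * 2)))
    seed-at {x} {y} t ±1 y<t x<t ≡1-mod-4 = y + K * t , x + L * t ,
      admissible (seed-ordered {K} {L} {x} (*-mono-< κ<ℓ κ<ℓ) y<t)
                 (seed-bounded {K} {L} {x} {y} ℓ²<3κ² x<t)
                 ≡1-mod-4
                 (subst₂ (Differ 4) (quadruple κ _) (quadruple ℓ _) (differ-*ˡ 4 (seed-differ {K = K} {L} t ±1)))
    seeded : (∃₂ λ x y → Differ 1 (K * x) (L * y)) → 2 ∣ κ ⊎ 2 ∣ ℓ →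
             ∃₂ (Admissible (κ * 2 * (κ * 2)) (ℓ * 2 * (ℓ * 2)))
    seeded (x , y , ±1) (inj₁ 2∣κ@(divides e κ≡e*2)) with odd-square ℓ-odd
      where
      ℓ-odd : ¬ 2 ∣ ℓ
      ℓ-odd 2∣ℓ = contradiction (coprime (2∣κ , 2∣ℓ)) λ ()
    ... | w , L≡1+4w = seed-at (y + 3 * x + 4) ±1 (m<m+3n+4 y x) (n<m+3n+4 y x)
      (seed-≡1-mod-4 {E = e * e} {w} (square≡4* e κ≡e*2) L≡1+4w y-odd)
      where
      y-odd : ¬ 2 ∣ y
      y-odd 2∣y = differ-1-parity ±1 (∣m⇒∣m*n x (∣m⇒∣m*n κ 2∣κ)) (∣n⇒∣m*n L 2∣y)
    seeded (x , y , ±1) (inj₂ 2∣ℓ@(divides e ℓ≡e*2)) with odd-square κ-odd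
      where
      κ-odd : ¬ 2 ∣ κ
      κ-odd 2∣κ = contradiction (coprime (2∣κ , 2∣ℓ)) λ ()
    ... | w , K≡1+4w = seed-at (x + 3 * y + 4) ±1 (n<m+3n+4 x y) (m<m+3n+4 x y)
      (subst (λ n → 4 ∣ n ∸ 1) (*-comm (x + L * _) (y + K * _))
        (seed-≡1-mod-4 {E = e * e} {w} (square≡4* e ℓ≡e*2) K≡1+4w x-odd))
      where
      x-odd : ¬ 2 ∣ x
      x-odd 2∣x = differ-1-parity (swap ±1) (∣m⇒∣m*n y (∣m⇒∣m*n ℓ 2∣ℓ)) (∣n⇒∣m*n K 2∣x)

  gcd[m*2,n*2]≡2⇒coprime : ∀ m n → gcd (m * 2) (n * 2) ≡ 2 → Coprime m n
  gcd[m*2,n*2]≡2⇒coprime m n gcd≡2 = gcd≡1⇒coprime (*-cancelˡ-≡ (gcd m n) 1 2 (begin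
    2 * gcd m n          ≡⟨ c*gcd[m,n]≡gcd[cm,cn] 2 m n ⟩
    gcd (2 * m) (2 * n)  ≡⟨ cong₂ gcd (*-comm 2 m) (*-comm 2 n) ⟩
    gcd (m * 2) (n * 2)  ≡⟨ gcd≡2 ⟩
    2                    ∎))
    where open ≡-Reasoning

  8∣m*2*[n*2]⇒2∣m⊎2∣n : ∀ m n → 8 ∣ m * 2 * (n * 2) → 2 ∣ m ⊎ 2 ∣ n
  8∣m*2*[n*2]⇒2∣m⊎2∣n m n 8∣ = euclidsLemma m n prime[2] (*-cancelˡ-∣ 4 (subst (8 ∣_) (solve m n) 8∣))
    where
    solve : ∀ m n → m * 2 * (n * 2) ≡ 4 * (m * n)
    solve = solve-∀

  halve-square-bound : ∀ m n → n * 2 * (n * 2) < 3 * (m * 2 * (m * 2)) → n * n < 3 * (m * m)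
  halve-square-bound m n bound = *-cancelˡ-< 4 (n * n) (3 * (m * m)) (subst₂ _<_ (solve₁ n) (solve₂ m) bound)
    where
    solve₁ : ∀ x → x * 2 * (x * 2) ≡ 4 * (x * x)
    solve₁ = solve-∀
    solve₂ : ∀ x → 3 * (x * 2 * (x * 2)) ≡ 4 * (3 * (x * x))
    solve₂ = solve-∀

open Arithmetic using (SquareFreeℕ; odd*odd)
open Admissibility

import Data.Nat.Base as ℕ
import Data.Nat.Properties as ℕ
open import Data.Nat.Coprimality using (gcd≡1⇒coprime)
open import Data.Nat.Divisibility using (divides; *-pres-∣)
open import Data.Integer.Base using (ℤ; +_; -[1+_]; -_; _+_; _-_; _*_; _<_; +<+)
open import Data.Integer.Divisibility using (_∣_)
open import Data.Integer.Properties using (pos-*; +-injective; drop‿+<+; neg-involutive; [+m]-[+n]≡m⊖n; ⊖-≥)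
open import Data.Integer.Tactic.RingSolver using (solve-∀)
open import Data.Product using (∃₂; _×_; _,_)
open import Data.Sum using (_⊎_; inj₁; inj₂)
open import Relation.Binary.PropositionalEquality
open import Relation.Nullary using (¬_)

ℤ-Differ : ℕ.ℕ → ℤ → ℤ → Set
ℤ-Differ e u v = u - v ≡ + e ⊎ u - v ≡ - (+ e)

+m-+n≡+o⇒m≡n+o : ∀ {m n o} → + m - + n ≡ + o → m ≡ n ℕ.+ o
+m-+n≡+o⇒m≡n+o {m} {n} eq = +-injective (trans (solve (+ m) (+ n)) (cong (_+_ (+ n)) eq))
  where
  solve : ∀ a b → a ≡ b + (a - b)
  solve = solve-∀

m≡n+o⇒+m-+n≡+o : ∀ {m n o} → m ≡ n ℕ.+ o → + m - + n ≡ + o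
m≡n+o⇒+m-+n≡+o {n = n} {o} refl = solve (+ n) (+ o)
  where
  solve : ∀ a c → a + c - a ≡ c
  solve = solve-∀

+n-+m≡-[+m-+n] : ∀ m n → + n - + m ≡ - (+ m - + n)
+n-+m≡-[+m-+n] m n = solve (+ m) (+ n)
  where
  solve : ∀ a b → b - a ≡ - (a - b)
  solve = solve-∀

ℤ-differ⇒differ : ∀ {e x y} → ℤ-Differ e (+ x) (+ y) → Differ e x y
ℤ-differ⇒differ (inj₁ eq) = inj₁ (+m-+n≡+o⇒m≡n+o eq)
ℤ-differ⇒differ {e} {x} {y} (inj₂ eq) =
  inj₂ (+m-+n≡+o⇒m≡n+o (trans (+n-+m≡-[+m-+n] x y) (trans (cong -_ eq) (neg-involutive (+ e)))))

differ⇒ℤ-differ : ∀ {e x y} → Differ e x y → ℤ-Differ e (+ x) (+ y)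
differ⇒ℤ-differ (inj₁ eq) = inj₁ (m≡n+o⇒+m-+n≡+o eq)
differ⇒ℤ-differ {e} {x} {y} (inj₂ eq) = inj₂ (begin
  + x - + y        ≡⟨ neg-involutive (+ x - + y) ⟨
  - (- (+ x - + y))  ≡⟨ cong -_ (+n-+m≡-[+m-+n] x y) ⟨
  - (+ y - + x)      ≡⟨ cong -_ (m≡n+o⇒+m-+n≡+o eq) ⟩
  - (+ e)            ∎)
  where open ≡-Reasoning

pos-*-* : ∀ a b c → + (a ℕ.* b ℕ.* c) ≡ + a * + b * + c
pos-*-* a b c = trans (pos-* (a ℕ.* b) c) (cong (_* + c) (pos-* a b))

+n-+1≡+[n∸1] : ∀ {n} → 1 ℕ.≤ n → + n - + 1 ≡ + (n ℕ.∸ 1)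
+n-+1≡+[n∸1] {n} 1≤n = trans ([+m]-[+n]≡m⊖n n 1) (⊖-≥ 1≤n)

+m*+n-+1≡+[m*n∸1] : ∀ {m n} → 1 ℕ.≤ m ℕ.* n → + m * + n - + 1 ≡ + (m ℕ.* n ℕ.∸ 1)
+m*+n-+1≡+[m*n∸1] {m} {n} 1≤mn = trans (cong (_- + 1) (sym (pos-* m n))) (+n-+1≡+[n∸1] 1≤mn)

good⇒admissible : ∀ {κ ℓ d₁ d₂} → Good (+ d₁) (+ d₂) (+ κ) (+ ℓ) → Admissible (κ ℕ.* κ) (ℓ ℕ.* ℓ) d₁ d₂
good⇒admissible {κ} {ℓ} {d₁} {d₂} (+<+ 0<d₁ , +<+ 0<d₂ , _ , d₁d₂≡1[4] , +<+ d₁<d₂ , d₂<3d₁ , ±4) =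
  admissible
    d₁<d₂
    (drop‿+<+ (subst (+ d₂ <_) (sym (pos-* 3 d₁)) d₂<3d₁))
    (subst (+ 4 ∣_) (+m*+n-+1≡+[m*n∸1] {d₁} {d₂} (ℕ.*-mono-≤ 0<d₁ 0<d₂)) d₁d₂≡1[4])
    (ℤ-differ⇒differ (subst₂ (ℤ-Differ 4) (sym (pos-*-* κ κ d₂)) (sym (pos-*-* ℓ ℓ d₁)) ±4))

admissible⇒good : ∀ {κ ℓ d₁ d₂} → Admissible (κ ℕ.* κ) (ℓ ℕ.* ℓ) d₁ d₂ → SquareFreeℕ (d₁ ℕ.* d₂) →
                  Good (+ d₁) (+ d₂) (+ κ) (+ ℓ)
admissible⇒good {κ} {ℓ} {d₁} {d₂} adm squarefree =
  +<+ 0<d₁ ,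
  +<+ (ℕ.<-trans 0<d₁ d₁<d₂) ,
  (λ m m²∣d₁d₂ → squarefree m (subst₂ _∣_ (sym (pos-* m m)) (sym (pos-* d₁ d₂)) m²∣d₁d₂)) ,
  subst (+ 4 ∣_) (sym (+m*+n-+1≡+[m*n∸1] {d₁} {d₂} 1≤d₁d₂)) d₁d₂≡1[4] ,
  +<+ d₁<d₂ ,
  subst (+ d₂ <_) (pos-* 3 d₁) (+<+ d₂<3d₁) ,
  subst₂ (ℤ-Differ 4) (pos-*-* κ κ d₂) (pos-*-* ℓ ℓ d₁) (differ⇒ℤ-differ Kd₂-Ld₁≡±4)
  where open Admissible adm

good-shifts : ∀ κ ℓ {B₁ B₂ b₁ b₂} → B₁ ≡ + b₁ → B₂ ≡ + b₂ → SquarefreeShifts (κ ℕ.* κ) (ℓ ℕ.* ℓ) b₁ b₂ →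
  ∀ d₁ d₂ → Good d₁ d₂ (+ κ) (+ ℓ) → InfinitelyMany (λ n → Good (d₁ + B₁ * n) (d₂ + B₂ * n) (+ κ) (+ ℓ))
good-shifts κ ℓ {b₁ = b₁} {b₂} refl refl shifts (+ d₁) (+ d₂) good N
  with shift shifts (good⇒admissible {κ} {ℓ} good) N
... | ν , N<ν , adm , squarefree = + ν , N<ν ,
  subst₂ (λ u v → Good u v (+ κ) (+ ℓ)) (cong (_+_ (+ d₁)) (pos-* b₁ ν)) (cong (_+_ (+ d₂)) (pos-* b₂ ν))
    (admissible⇒good {κ} {ℓ} adm squarefree)
good-shifts _ _ _ _ _ -[1+ _ ] _        (() , _)     _
good-shifts _ _ _ _ _ (+ _)    -[1+ _ ] (_ , () , _) _

good-exists : ∀ κ ℓ {b₁ b₂} → ∃₂ (Admissible (κ ℕ.* κ) (ℓ ℕ.* ℓ)) →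
              SquarefreeShifts (κ ℕ.* κ) (ℓ ℕ.* ℓ) b₁ b₂ → ∃₂ λ d₁ d₂ → Good d₁ d₂ (+ κ) (+ ℓ)
good-exists κ ℓ (_ , _ , adm) shifts with shift shifts adm 0
... | _ , _ , shifted , squarefree = _ , _ , admissible⇒good {κ} {ℓ} shifted squarefree

even-good-exists : ∀ κ ℓ {b₁ b₂} → CaseB (+ κ) (+ ℓ) → κ ℕ.< ℓ → ℓ ℕ.* ℓ ℕ.< 3 ℕ.* (κ ℕ.* κ) →
                   SquarefreeShifts (κ ℕ.* κ) (ℓ ℕ.* ℓ) b₁ b₂ → ∃₂ λ d₁ d₂ → Good d₁ d₂ (+ κ) (+ ℓ)
even-good-exists _ _ (divides κ refl , divides ℓ refl , gcd≡2 , 8∣κℓ) 2κ<2ℓ 4ℓ²<12κ² =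
  good-exists (κ ℕ.* 2) (ℓ ℕ.* 2) (even-seed
    (gcd[m*2,n*2]≡2⇒coprime κ ℓ (+-injective gcd≡2))
    (8∣m*2*[n*2]⇒2∣m⊎2∣n κ ℓ (subst (+ 8 ∣_) (sym (pos-* (κ ℕ.* 2) (ℓ ℕ.* 2))) 8∣κℓ))
    (ℕ.*-cancelʳ-< 2 κ ℓ 2κ<2ℓ)
    (halve-square-bound κ ℓ 4ℓ²<12κ²))

theorem5p9 : (k l : ℤ) → + 0 < k → k < l → l * l < + 3 * (k * k) → (CaseA k l ⊎ CaseB k l)
    → (∃₂ λ d₁ d₂ → Good d₁ d₂ k l)
      × (CaseA k l → ∀ d₁ d₂ → Good d₁ d₂ k l
           → InfinitelyMany (λ n → Good (d₁ + + 2 * (k * k) * n) (d₂ + + 2 * (l * l) * n) k l))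
      × (CaseB k l → ∀ d₁ d₂ → Good d₁ d₂ k l
           → InfinitelyMany (λ n → Good (d₁ + k * k * n) (d₂ + l * l * n) k l))
theorem5p9 (+ κ) (+ ℓ) _ (+<+ κ<ℓ) ℓ²<3κ² cases =
  existence cases ,
  (λ (κ-odd , ℓ-odd , _) → good-shifts κ ℓ (pos-2* κ) (pos-2* ℓ) (odd-shifts κ-odd ℓ-odd)) ,
  (λ (2∣κ , 2∣ℓ , _) → good-shifts κ ℓ (sym (pos-* κ κ)) (sym (pos-* ℓ ℓ)) (even-shifts 2∣κ 2∣ℓ))
  where
  L<3K : ℓ ℕ.* ℓ ℕ.< 3 ℕ.* (κ ℕ.* κ)
  L<3K = drop‿+<+ (subst₂ _<_ (sym (pos-* ℓ ℓ)) (trans (cong (+ 3 *_) (sym (pos-* κ κ))) (sym (pos-* 3 (κ ℕ.* κ))))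
                    ℓ²<3κ²)
  K≤L = ℕ.<⇒≤ (ℕ.*-mono-< κ<ℓ κ<ℓ)
  L≤3K = ℕ.<⇒≤ L<3K
  pos-2* : ∀ x → + 2 * (+ x * + x) ≡ + (2 ℕ.* (x ℕ.* x))
  pos-2* x = trans (cong (+ 2 *_) (sym (pos-* x x))) (sym (pos-* 2 (x ℕ.* x)))
  odd-shifts : ¬ (+ 2 ∣ + κ) → ¬ (+ 2 ∣ + ℓ) →
               SquarefreeShifts (κ ℕ.* κ) (ℓ ℕ.* ℓ) (2 ℕ.* (κ ℕ.* κ)) (2 ℕ.* (ℓ ℕ.* ℓ))
  odd-shifts κ-odd ℓ-odd = odd-squarefree-shifts (odd*odd κ-odd κ-odd) (odd*odd ℓ-odd ℓ-odd) K≤L L≤3K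
  even-shifts : + 2 ∣ + κ → + 2 ∣ + ℓ → SquarefreeShifts (κ ℕ.* κ) (ℓ ℕ.* ℓ) (κ ℕ.* κ) (ℓ ℕ.* ℓ)
  even-shifts 2∣κ 2∣ℓ = even-squarefree-shifts (*-pres-∣ 2∣κ 2∣κ) (*-pres-∣ 2∣ℓ 2∣ℓ) K≤L L≤3K
  existence : CaseA (+ κ) (+ ℓ) ⊎ CaseB (+ κ) (+ ℓ) → ∃₂ λ d₁ d₂ → Good d₁ d₂ (+ κ) (+ ℓ)
  existence (inj₁ (κ-odd , ℓ-odd , gcd≡1)) =
    good-exists κ ℓ (odd-seed κ-odd ℓ-odd (gcd≡1⇒coprime (+-injective gcd≡1)) κ<ℓ L<3K) (odd-shifts κ-odd ℓ-odd)
  existence (inj₂ caseB@(2∣κ , 2∣ℓ , _)) = even-good-exists κ ℓ caseB κ<ℓ L<3K (even-shifts 2∣κ 2∣ℓ)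
theorem5p9 -[1+ _ ] _        ()  _  _ _
theorem5p9 (+ _)    -[1+ _ ] _   () _ _
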